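{- Let $k\in\mathbb{N}$ and let $d_k(n)$ denote the number of ordered $k$-tuples $(x_1,\ldots,x_k)$ of positive integers with $x_1\cdots x_k=n$ (the Piltz divisor function). Let $\vartheta_k:\mathbb{N}^2\to\mathbb{C}$ be the multiplicative function of two variables defined, for every prime $p$ and every $\nu_1,\nu_2\in\mathbb{N}_0$, by \[ \vartheta_k(p^{\nu_1},p^{\nu_2})= \begin{cases} 1, & \nu_1=\nu_2=0,\\ (-1)^{\nu_1+\nu_2-1} \binom{k}{\nu_1+\nu_2}, & \nu_1,\nu_2\ge 1,\ \nu_1+\nu_2 \le k,\\ 0, & \text{otherwise}. \end{cases} \] Then for every $n_1,n_2\in\mathbb{N}$, \[ d_k(n_1n_2) = \sum_{a_1\mid n_1, \, a_2\mid n_2} d_k\left(\frac{n_1}{a_1}\right) d_k\left(\frac{n_2}{a_2}\right)\vartheta_k(a_1,a_2). \]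
   Context: $\mathbb{N}=\{1,2,\ldots\}$, $\mathbb{N}_0=\{0,1,2,\ldots\}$. A function $G:\mathbb{N}^2\to\mathbb{C}$ is multiplicative if it is not identically zero and $G(m_1n_1,m_2n_2)=G(m_1,m_2)G(n_1,n_2)$ whenever $\gcd(m_1m_2,n_1n_2)=1$; it then satisfies $G(n_1,n_2)=\prod_p G(p^{\nu_p(n_1)},p^{\nu_p(n_2)})$, so it is determined by its values on pairs of powers of the same prime. -}

module Defs where

open import Data.Nat as ℕ using (ℕ; zero; suc; _≟_; _≤_; _≤ᵇ_)
open import Data.Nat.DivMod using (_/_)
import Data.Nat.ListAction as ListAction
open import Data.Nat.Divisibility using (_∣?_)
open import Data.Nat.Combinatorics using (_C_)
open import Data.Nat.Coprimality using (Coprime)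
open import Data.Integer as ℤ using (ℤ; +_; -_)
open import Data.Bool using (if_then_else_)
open import Data.List as List using (List; []; _∷_; upTo; filter; length; concatMap; map; foldr)
open import Data.Vec as Vec using (Vec; []; _∷_)
open import Relation.Nullary using (does)
open import Relation.Binary.PropositionalEquality using (_≡_)
open import Data.Product using (Σ; _×_; ∃)
open import Relation.Nullary using (¬_)

tuples : (k n : ℕ) → List (Vec ℕ k)
tuples zero    n = [] ∷ []
tuples (suc k) n = concatMap (λ x → map (λ v → suc x ∷ v) (tuples k n)) (upTo n)

-- Piltz divisor function (for n ≥ 1): number of ordered k-tuples of
-- positive integers with product n (each entry is then ≤ n)
d : ℕ → ℕ → ℕ
d k n = length (filter (λ v → ListAction.product (Vec.toList v) ≟ n) (tuples k n))

sign : ℕ → ℤ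
sign zero          = + 1
sign (suc zero)    = - (+ 1)
sign (suc (suc m)) = sign m

-- prescribed value of ϑ_k(p^ν₁, p^ν₂)
θval : ℕ → ℕ → ℕ → ℤ
θval k zero     zero     = + 1
θval k zero     (suc _)  = + 0
θval k (suc _)  zero     = + 0
θval k (suc a) (suc b) =
  if (suc a ℕ.+ suc b) ≤ᵇ k
  then sign (suc a ℕ.+ b) ℤ.* (+ (k C (suc a ℕ.+ suc b)))
  else + 0

-- multiplicative functions of two variables (G is only meaningful on
-- positive arguments, written suc m)
IsMultiplicative₂ : (ℕ → ℕ → ℤ) → Set
IsMultiplicative₂ G =
  (∃ λ m₁ → ∃ λ m₂ → ¬ (G (suc m₁) (suc m₂) ≡ + 0))
  × (∀ m₁ m₂ n₁ n₂ → Coprime (suc m₁ ℕ.* suc m₂) (suc n₁ ℕ.* suc n₂) →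
       G (suc m₁ ℕ.* suc n₁) (suc m₂ ℕ.* suc n₂) ≡ G (suc m₁) (suc m₂) ℤ.* G (suc n₁) (suc n₂))

sumℤ : List ℤ → ℤ
sumℤ = foldr ℤ._+_ (+ 0)

-- Σ_{a ∣ n} f a  for n ≥ 1, where a = suc i ranges over 1..n; f receives i
divSum : ℕ → (ℕ → ℤ) → ℤ
divSum n f = sumℤ (map (λ i → if does (suc i ∣? n) then f i else + 0) (upTo n))

rhs : ℕ → (ℕ → ℕ → ℤ) → ℕ → ℕ → ℤ
rhs k G n₁ n₂ = divSum n₁ (λ i₁ → divSum n₂ (λ i₂ →
  ℤ.+ (d k (n₁ / suc i₁)) ℤ.* ℤ.+ (d k (n₂ / suc i₂)) ℤ.* G (suc i₁) (suc i₂)))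

-- Both sides are multiplicative in (n₁, n₂): the left side because d_k is, the right side
-- because it is the two-variable Dirichlet convolution of ϑ_k with d_k ⊗ d_k. So it suffices
-- to compare them at (p^a, p^b). There d_k(p^m) = E(m), the coefficient of x^m in (1-x)^-k,
-- and ϑ_k(p^i, p^j) = -c(i+j) for i, j ≥ 1, where c(m) = (-1)^m C(k,m) is the coefficient of
-- x^m in (1-x)^k. Summing over j first, Σ_{j≤b} E(b-j) ϑ_k(p^i, p^j) is the coefficient of x^i
-- in (1-x)^k Σ_m E(b+m) x^m: for i ≥ 1 the difference is the coefficient of x^(i+b) in
-- (1-x)^k (1-x)^-k = 1, which vanishes. Multiplying by (1-x)^-k and reading off x^a then
-- gives E(a+b) = d_k(p^(a+b)).

module Submission where

open import Data.Bool using (true; false; if_then_else_)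
open import Data.Empty using (⊥-elim)
open import Data.Integer as ℤ using (ℤ; +_; -_; _+_; _-_) renaming (_*_ to _·_)
import Data.Integer.Properties as ℤ
open import Data.Integer.Tactic.RingSolver using (solve-∀)
open import Algebra.Properties.CommutativeSemigroup ℤ.+-commutativeSemigroup using ()
  renaming (interchange to +-interchange)
open import Algebra.Properties.CommutativeSemigroup ℤ.*-commutativeSemigroup using ()
  renaming (interchange to ·-interchange)
open import Algebra.Properties.AbelianGroup ℤ.+-0-abelianGroup using (inverseˡ-unique)
open import Data.List as List using (List; []; _∷_; map; upTo; applyUpTo; filter; length; concatMap)
open import Data.List.Properties using (length-map; length-++; filter-++; filter-≐; filter-none)
open import Data.List.Relation.Unary.All using (_∷_; universal)
open import Data.Nat as ℕ using (ℕ; zero; suc; _*_; _∸_; _^_; _<_; _≤_; z≤n; s≤s; NonZero)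
import Data.Nat.Properties as ℕ
open import Data.Nat.Combinatorics using (_C_; k>n⇒nCk≡0; nCk+nC[k+1]≡[n+1]C[k+1])
open import Data.Nat.Coprimality as Coprime using (Coprime; coprime-divisor)
open import Data.Nat.Divisibility
open import Data.Nat.DivMod using (_/_; m*n/n≡m; m*[n/m]≡n)
open import Data.Nat.GCD using (gcd; gcd[m,n]∣m; gcd[m,n]∣n; gcd-greatest; c*gcd[m,n]≡gcd[cm,cn]; gcd[m,n]≢0)
open import Data.Nat.Induction using (<-rec)
open import Data.Nat.ListAction using (product)
open import Data.Nat.Primality
  using (Prime; prime⇒nonZero; prime⇒nonTrivial; prime⇒irreducible; euclidsLemma; prime[2])
open import Data.Nat.Primality.Factorisation using (factorise)
open import Data.Product using (∃; ∃₂; _×_; _,_)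
open import Data.Sum using (inj₁; inj₂)
open import Data.Vec as Vec using (Vec; toList)
open import Function using (_∘_)
open import Level using (0ℓ)
open import Relation.Binary using (tri<; tri≈; tri>)
open import Relation.Binary.PropositionalEquality
open import Relation.Nullary using (Dec; does; yes; no; ¬_; _×-dec_)
open import Relation.Nullary.Reflects using (ofʸ; ofⁿ)
open import Relation.Unary using (Pred; Decidable)

open import Defs

∑< : ℕ → (ℕ → ℤ) → ℤ
∑< zero    f = + 0
∑< (suc n) f = ∑< n f + f n

infixl 10 ∑<
syntax ∑< n (λ i → e) = ∑[ i < n ] e

∑-cong-< : ∀ n {f g : ℕ → ℤ} → (∀ i → i < n → f i ≡ g i) → ∑< n f ≡ ∑< n g
∑-cong-< zero    eq = refl
∑-cong-< (suc n) eq = cong₂ _+_ (∑-cong-< n (λ i i<n → eq i (ℕ.m<n⇒m<1+n i<n))) (eq n ℕ.≤-refl)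

∑-cong : ∀ n {f g : ℕ → ℤ} → (∀ i → f i ≡ g i) → ∑< n f ≡ ∑< n g
∑-cong n eq = ∑-cong-< n (λ i _ → eq i)

∑-zero : ∀ n {f : ℕ → ℤ} → (∀ i → i < n → f i ≡ + 0) → ∑< n f ≡ + 0
∑-zero n eq = trans (∑-cong-< n eq) (∑-const0 n)
  where
  ∑-const0 : ∀ n → ∑[ i < n ] (+ 0) ≡ + 0
  ∑-const0 zero    = refl
  ∑-const0 (suc n) = cong (_+ + 0) (∑-const0 n)

∑-distrib-+ : ∀ n (f g : ℕ → ℤ) → ∑[ i < n ] (f i + g i) ≡ ∑< n f + ∑< n g
∑-distrib-+ zero    f g = refl
∑-distrib-+ (suc n) f g = begin
  ∑[ i < n ] (f i + g i) + (f n + g n)   ≡⟨ cong (_+ (f n + g n)) (∑-distrib-+ n f g) ⟩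
  (∑< n f + ∑< n g) + (f n + g n)        ≡⟨ +-interchange (∑< n f) (∑< n g) (f n) (g n) ⟩
  (∑< n f + f n) + (∑< n g + g n)        ∎
  where open ≡-Reasoning

∑-distribˡ-· : ∀ n c (f : ℕ → ℤ) → c · ∑< n f ≡ ∑[ i < n ] (c · f i)
∑-distribˡ-· zero    c f = ℤ.*-zeroʳ c
∑-distribˡ-· (suc n) c f =
  trans (ℤ.*-distribˡ-+ c (∑< n f) (f n)) (cong (_+ c · f n) (∑-distribˡ-· n c f))

∑-distribʳ-· : ∀ n c (f : ℕ → ℤ) → ∑< n f · c ≡ ∑[ i < n ] (f i · c)
∑-distribʳ-· n c f = begin
  ∑< n f · c             ≡⟨ ℤ.*-comm (∑< n f) c ⟩
  c · ∑< n f             ≡⟨ ∑-distribˡ-· n c f ⟩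
  ∑[ i < n ] (c · f i)   ≡⟨ ∑-cong n (λ i → ℤ.*-comm c (f i)) ⟩
  ∑[ i < n ] (f i · c)   ∎
  where open ≡-Reasoning

∑-neg : ∀ n (f : ℕ → ℤ) → - ∑< n f ≡ ∑[ i < n ] (- f i)
∑-neg zero    f = refl
∑-neg (suc n) f = trans (ℤ.neg-distrib-+ (∑< n f) (f n)) (cong (_+ - f n) (∑-neg n f))

∑-head : ∀ n (f : ℕ → ℤ) → ∑< (suc n) f ≡ f 0 + ∑[ i < n ] f (suc i)
∑-head zero    f = trans (ℤ.+-identityˡ (f 0)) (sym (ℤ.+-identityʳ (f 0)))
∑-head (suc n) f = trans (cong (_+ f (suc n)) (∑-head n f)) (ℤ.+-assoc (f 0) _ _)

∑-split : ∀ m n (f : ℕ → ℤ) → ∑< (m ℕ.+ n) f ≡ ∑< m f + ∑[ i < n ] f (m ℕ.+ i)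
∑-split m zero    f = trans (cong (λ k → ∑< k f) (ℕ.+-identityʳ m)) (sym (ℤ.+-identityʳ _))
∑-split m (suc n) f = begin
  ∑< (m ℕ.+ suc n) f                                  ≡⟨ cong (λ k → ∑< k f) (ℕ.+-suc m n) ⟩
  ∑< (m ℕ.+ n) f + f (m ℕ.+ n)                        ≡⟨ cong (_+ f (m ℕ.+ n)) (∑-split m n f) ⟩
  ∑< m f + ∑[ i < n ] f (m ℕ.+ i) + f (m ℕ.+ n)       ≡⟨ ℤ.+-assoc (∑< m f) _ _ ⟩
  ∑< m f + ∑[ i < suc n ] f (m ℕ.+ i)                 ∎
  where open ≡-Reasoning

∑-comm : ∀ m n (f : ℕ → ℕ → ℤ) → ∑[ i < m ] ∑[ j < n ] f i j ≡ ∑[ j < n ] ∑[ i < m ] f i j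
∑-comm zero    n f = sym (∑-zero n (λ _ _ → refl))
∑-comm (suc m) n f = trans (cong (_+ ∑< n (f m)) (∑-comm m n f))
                           (sym (∑-distrib-+ n (λ j → ∑[ i < m ] f i j) (f m)))

∑-select : ∀ n w (f : ℕ → ℤ) → w < n → (∀ i → i < n → i ≢ w → f i ≡ + 0) → ∑< n f ≡ f w
∑-select (suc n) w f w<1+n others with w ℕ.≟ n
... | yes refl = trans (cong (_+ f w) (∑-zero n (λ i i<n → others i (ℕ.m<n⇒m<1+n i<n) (ℕ.<⇒≢ i<n))))
                       (ℤ.+-identityˡ (f w))
... | no w≢n   = trans (cong₂ _+_ (∑-select n w f (ℕ.≤∧≢⇒< (ℕ.≤-pred w<1+n) w≢n)
                                      (λ i i<n → others i (ℕ.m<n⇒m<1+n i<n)))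
                                  (others n ℕ.≤-refl (w≢n ∘ sym)))
                       (ℤ.+-identityʳ (f w))

∑-vanishing-tail : ∀ m n (f : ℕ → ℤ) → m ≤ n → (∀ i → m ≤ i → i < n → f i ≡ + 0) → ∑< n f ≡ ∑< m f
∑-vanishing-tail m n f m≤n tail with ℕ.m≤n⇒∃[o]m+o≡n m≤n
... | o , refl = trans (∑-split m o f) (trans (cong (_+_ (∑< m f)) tail≡0) (ℤ.+-identityʳ _))
  where
  tail≡0 : ∑[ i < o ] f (m ℕ.+ i) ≡ + 0
  tail≡0 = ∑-zero o (λ i i<o → tail (m ℕ.+ i) (ℕ.m≤m+n m i) (ℕ.+-monoʳ-< m i<o))

∑-reverse : ∀ m (f : ℕ → ℤ) → ∑< (suc m) f ≡ ∑[ i < suc m ] f (m ∸ i)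
∑-reverse zero    f = refl
∑-reverse (suc m) f = begin
  ∑< (suc m) f + f (suc m)                        ≡⟨ cong (_+ f (suc m)) (∑-reverse m f) ⟩
  ∑[ i < suc m ] f (m ∸ i) + f (suc m)            ≡⟨ ℤ.+-comm _ (f (suc m)) ⟩
  f (suc m) + ∑[ i < suc m ] f (m ∸ i)            ≡⟨ sym (∑-head (suc m) (λ i → f (suc m ∸ i))) ⟩
  ∑[ i < suc (suc m) ] f (suc m ∸ i)              ∎
  where open ≡-Reasoning

sumℤ-upTo : ∀ n (f : ℕ → ℤ) → sumℤ (map f (upTo n)) ≡ ∑< n f
sumℤ-upTo n f = sumℤ-applyUpTo n (λ i → i)
  where
  sumℤ-applyUpTo : ∀ n (g : ℕ → ℕ) → sumℤ (map f (applyUpTo g n)) ≡ ∑< n (f ∘ g)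
  sumℤ-applyUpTo zero    g = refl
  sumℤ-applyUpTo (suc n) g =
    trans (cong (_+_ (f (g 0))) (sumℤ-applyUpTo n (g ∘ suc))) (sym (∑-head n (f ∘ g)))

∑-triangle : ∀ m (F : ℕ → ℕ → ℤ) →
  ∑[ i < suc m ] ∑[ j < suc (m ∸ i) ] F i j ≡ ∑[ s < suc m ] ∑[ i < suc s ] F i (s ∸ i)
∑-triangle zero    F = refl
∑-triangle (suc m) F = begin
  ∑[ i < suc m ] ∑[ j < suc (suc m ∸ i) ] F i j + ∑[ j < suc (m ∸ m) ] F (suc m) j
    ≡⟨ cong₂ _+_ (∑-cong-< (suc m) (λ i i≤m → cong (λ t → ∑< (suc t) (F i)) (1+m∸i i≤m)))
                 (cong (λ t → ∑< (suc t) (F (suc m))) (ℕ.n∸n≡0 m)) ⟩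
  ∑[ i < suc m ] (∑[ j < suc (m ∸ i) ] F i j + F i (suc (m ∸ i))) + (+ 0 + F (suc m) 0)
    ≡⟨ cong (_+ (+ 0 + F (suc m) 0)) (∑-distrib-+ (suc m) _ _) ⟩
  ∑[ i < suc m ] ∑[ j < suc (m ∸ i) ] F i j + ∑[ i < suc m ] F i (suc (m ∸ i)) + (+ 0 + F (suc m) 0)
    ≡⟨ ℤ.+-assoc (∑[ i < suc m ] ∑[ j < suc (m ∸ i) ] F i j) _ _ ⟩
  ∑[ i < suc m ] ∑[ j < suc (m ∸ i) ] F i j + (∑[ i < suc m ] F i (suc (m ∸ i)) + (+ 0 + F (suc m) 0))
    ≡⟨ cong₂ _+_ (∑-triangle m F) (cong₂ _+_ diagonal (trans (ℤ.+-identityˡ _) (cong (F (suc m)) (sym (ℕ.n∸n≡0 m))))) ⟩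
  ∑[ s < suc m ] ∑[ i < suc s ] F i (s ∸ i) + ∑[ i < suc (suc m) ] F i (suc m ∸ i)
    ∎
  where
  open ≡-Reasoning
  1+m∸i : ∀ {i} → i < suc m → suc m ∸ i ≡ suc (m ∸ i)
  1+m∸i i≤m = ℕ.+-∸-assoc 1 (ℕ.≤-pred i≤m)
  diagonal : ∑[ i < suc m ] F i (suc (m ∸ i)) ≡ ∑[ i < suc m ] F i (suc m ∸ i)
  diagonal = ∑-cong-< (suc m) (λ i i≤m → cong (F i) (sym (1+m∸i i≤m)))

-- Power series

infixl 7 _⋆_

_⋆_ : (ℕ → ℤ) → (ℕ → ℤ) → ℕ → ℤ
(f ⋆ g) m = ∑[ i < suc m ] (f i · g (m ∸ i))

δ : ℕ → ℤ
δ zero    = + 1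
δ (suc _) = + 0

⋆-cong : ∀ {f f′ g g′ : ℕ → ℤ} → f ≗ f′ → g ≗ g′ → f ⋆ g ≗ f′ ⋆ g′
⋆-cong f≗f′ g≗g′ m = ∑-cong (suc m) (λ i → cong₂ _·_ (f≗f′ i) (g≗g′ (m ∸ i)))

⋆-congˡ : ∀ {f f′ : ℕ → ℤ} g → f ≗ f′ → f ⋆ g ≗ f′ ⋆ g
⋆-congˡ g f≗f′ = ⋆-cong {g = g} {g′ = g} f≗f′ (λ _ → refl)

⋆-congʳ : ∀ f {g g′ : ℕ → ℤ} → g ≗ g′ → f ⋆ g ≗ f ⋆ g′
⋆-congʳ f = ⋆-cong {f = f} {f′ = f} (λ _ → refl)

⋆-comm : ∀ f g → f ⋆ g ≗ g ⋆ f
⋆-comm f g m = trans (∑-reverse m _) (∑-cong-< (suc m) λ i i≤m → begin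
  f (m ∸ i) · g (m ∸ (m ∸ i))   ≡⟨ cong (λ t → f (m ∸ i) · g t) (ℕ.m∸[m∸n]≡n (ℕ.≤-pred i≤m)) ⟩
  f (m ∸ i) · g i               ≡⟨ ℤ.*-comm (f (m ∸ i)) (g i) ⟩
  g i · f (m ∸ i)               ∎)
  where open ≡-Reasoning

⋆-assoc : ∀ f g h → (f ⋆ g) ⋆ h ≗ f ⋆ (g ⋆ h)
⋆-assoc f g h m = begin
  ∑[ s < suc m ] (∑[ i < suc s ] (f i · g (s ∸ i)) · h (m ∸ s))
    ≡⟨ ∑-cong (suc m) (λ s → ∑-distribʳ-· (suc s) (h (m ∸ s)) _) ⟩
  ∑[ s < suc m ] ∑[ i < suc s ] (f i · g (s ∸ i) · h (m ∸ s))
    ≡⟨ ∑-cong (suc m) (λ s → ∑-cong-< (suc s) (λ i i≤s →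
         cong (λ t → f i · g (s ∸ i) · h t) (sym (∸-∸-cancel (ℕ.≤-pred i≤s))))) ⟩
  ∑[ s < suc m ] ∑[ i < suc s ] (f i · g (s ∸ i) · h (m ∸ i ∸ (s ∸ i)))
    ≡⟨ sym (∑-triangle m (λ i j → f i · g j · h (m ∸ i ∸ j))) ⟩
  ∑[ i < suc m ] ∑[ j < suc (m ∸ i) ] (f i · g j · h (m ∸ i ∸ j))
    ≡⟨ ∑-cong (suc m) (λ i → trans (∑-cong (suc (m ∸ i)) (λ j → ℤ.*-assoc (f i) _ _))
                                   (sym (∑-distribˡ-· (suc (m ∸ i)) (f i) _))) ⟩
  ∑[ i < suc m ] (f i · (g ⋆ h) (m ∸ i))
    ∎
  where
  open ≡-Reasoning
  ∸-∸-cancel : ∀ {i s} → i ≤ s → m ∸ i ∸ (s ∸ i) ≡ m ∸ s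
  ∸-∸-cancel {i} {s} i≤s = trans (ℕ.∸-+-assoc m i (s ∸ i)) (cong (m ∸_) (ℕ.m+[n∸m]≡n i≤s))

⋆-identityˡ : ∀ f → δ ⋆ f ≗ f
⋆-identityˡ f m = begin
  ∑[ i < suc m ] (δ i · f (m ∸ i))                  ≡⟨ ∑-head m _ ⟩
  + 1 · f m + ∑[ i < m ] (+ 0 · f (m ∸ suc i))      ≡⟨ cong₂ _+_ (ℤ.*-identityˡ (f m)) (∑-zero m (λ _ _ → refl)) ⟩
  f m + + 0                                         ≡⟨ ℤ.+-identityʳ (f m) ⟩
  f m                                               ∎
  where open ≡-Reasoning

-- The coefficients of (1-x)^-k and (1-x)^k

𝟙 : ℕ → ℤ
𝟙 _ = + 1

geometric^ : ℕ → ℕ → ℤ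
geometric^ zero    = δ
geometric^ (suc k) = 𝟙 ⋆ geometric^ k

[1-x] : ℕ → ℤ
[1-x] zero          = + 1
[1-x] (suc zero)    = - + 1
[1-x] (suc (suc _)) = + 0

[1-x]^ : ℕ → ℕ → ℤ
[1-x]^ k m = sign m · + (k C m)

sign-suc : ∀ m → sign (suc m) ≡ - sign m
sign-suc zero    = refl
sign-suc (suc m) = trans (sym (ℤ.neg-involutive (sign m))) (cong -_ (sym (sign-suc m)))

[1-x]⋆-suc : ∀ f m → ([1-x] ⋆ f) (suc m) ≡ f (suc m) - f m
[1-x]⋆-suc f m = begin
  ([1-x] ⋆ f) (suc m)
    ≡⟨ ∑-head (suc m) _ ⟩
  + 1 · f (suc m) + ∑[ i < suc m ] ([1-x] (suc i) · f (m ∸ i))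
    ≡⟨ cong (_+_ (+ 1 · f (suc m))) (∑-head m _) ⟩
  + 1 · f (suc m) + (- + 1 · f m + ∑[ i < m ] (+ 0 · f (m ∸ suc i)))
    ≡⟨ cong (λ t → + 1 · f (suc m) + (- + 1 · f m + t)) (∑-zero m (λ _ _ → refl)) ⟩
  + 1 · f (suc m) + (- + 1 · f m + + 0)
    ≡⟨ simplify (f (suc m)) (f m) ⟩
  f (suc m) - f m
    ∎
  where
  open ≡-Reasoning
  simplify : ∀ x y → + 1 · x + (- + 1 · y + + 0) ≡ x - y
  simplify = solve-∀

𝟙⋆[1-x] : 𝟙 ⋆ [1-x] ≗ δ
𝟙⋆[1-x] zero    = refl
𝟙⋆[1-x] (suc m) = trans (⋆-comm 𝟙 [1-x] (suc m)) ([1-x]⋆-suc 𝟙 m)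

[1-x]^-zero : [1-x]^ 0 ≗ δ
[1-x]^-zero zero    = refl
[1-x]^-zero (suc m) = trans (cong (λ c → sign (suc m) · + c) (k>n⇒nCk≡0 {0} {suc m} (s≤s z≤n)))
                            (ℤ.*-zeroʳ (sign (suc m)))

[1-x]^-suc : ∀ k → [1-x]^ (suc k) ≗ [1-x] ⋆ [1-x]^ k
[1-x]^-suc k zero    = refl
[1-x]^-suc k (suc m) = begin
  sign (suc m) · + (suc k C suc m)
    ≡⟨ cong (λ c → sign (suc m) · + c) (sym (nCk+nC[k+1]≡[n+1]C[k+1] k m)) ⟩
  sign (suc m) · + (k C m ℕ.+ k C suc m)
    ≡⟨ cong₂ _·_ (sign-suc m) (ℤ.pos-+ (k C m) (k C suc m)) ⟩
  - sign m · (+ (k C m) + + (k C suc m))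
    ≡⟨ distribute (sign m) (+ (k C m)) (+ (k C suc m)) ⟩
  - sign m · + (k C suc m) - [1-x]^ k m
    ≡⟨ cong (λ s → s · + (k C suc m) - [1-x]^ k m) (sym (sign-suc m)) ⟩
  [1-x]^ k (suc m) - [1-x]^ k m
    ≡⟨ sym ([1-x]⋆-suc ([1-x]^ k) m) ⟩
  ([1-x] ⋆ [1-x]^ k) (suc m)
    ∎
  where
  open ≡-Reasoning
  distribute : ∀ s a b → - s · (a + b) ≡ - s · b - s · a
  distribute = solve-∀

geometric^⋆[1-x]^ : ∀ k → geometric^ k ⋆ [1-x]^ k ≗ δ
geometric^⋆[1-x]^ zero    m = trans (⋆-identityˡ ([1-x]^ 0) m) ([1-x]^-zero m)
geometric^⋆[1-x]^ (suc k) m = begin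
  (𝟙 ⋆ E ⋆ [1-x]^ (suc k)) m    ≡⟨ ⋆-congʳ (𝟙 ⋆ E) ([1-x]^-suc k) m ⟩
  (𝟙 ⋆ E ⋆ ([1-x] ⋆ c)) m       ≡⟨ ⋆-assoc 𝟙 E ([1-x] ⋆ c) m ⟩
  (𝟙 ⋆ (E ⋆ ([1-x] ⋆ c))) m     ≡⟨ ⋆-congʳ 𝟙 (λ i → ⋆-congʳ E (⋆-comm [1-x] c) i) m ⟩
  (𝟙 ⋆ (E ⋆ (c ⋆ [1-x]))) m     ≡⟨ ⋆-congʳ 𝟙 (λ i → sym (⋆-assoc E c [1-x] i)) m ⟩
  (𝟙 ⋆ (E ⋆ c ⋆ [1-x])) m       ≡⟨ ⋆-congʳ 𝟙 (⋆-congˡ [1-x] (geometric^⋆[1-x]^ k)) m ⟩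
  (𝟙 ⋆ (δ ⋆ [1-x])) m           ≡⟨ ⋆-congʳ 𝟙 (⋆-identityˡ [1-x]) m ⟩
  (𝟙 ⋆ [1-x]) m                 ≡⟨ 𝟙⋆[1-x] m ⟩
  δ m                           ∎
  where
  open ≡-Reasoning
  E c : ℕ → ℤ
  E = geometric^ k
  c = [1-x]^ k

-- ϑ_k at prime powers

if-≤ᵇ-elim : ∀ {m n} {x y z : ℤ} → (m ≤ n → x ≡ z) → (¬ m ≤ n → y ≡ z) → (if m ℕ.≤ᵇ n then x else y) ≡ z
if-≤ᵇ-elim {m} {n} yes-case no-case with m ℕ.≤ᵇ n | ℕ.≤ᵇ-reflects-≤ m n
... | true  | ofʸ m≤n = yes-case m≤n
... | false | ofⁿ m≰n = no-case m≰n

θval-suc-suc : ∀ k a b → θval k (suc a) (suc b) ≡ - [1-x]^ k (suc a ℕ.+ suc b)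
θval-suc-suc k a b = if-≤ᵇ-elim (λ _ → sign-flip) (λ n≰k → sym (binomial-vanishes n≰k))
  where
  open ≡-Reasoning
  n : ℕ
  n = suc a ℕ.+ suc b
  sign-flip : sign (suc a ℕ.+ b) · + (k C n) ≡ - [1-x]^ k n
  sign-flip = begin
    sign (suc a ℕ.+ b) · + (k C n)          ≡⟨ cong (_· + (k C n)) (sym (ℤ.neg-involutive (sign (suc a ℕ.+ b)))) ⟩
    - - sign (suc a ℕ.+ b) · + (k C n)      ≡⟨ cong (λ s → - s · + (k C n)) (sym (sign-suc (suc a ℕ.+ b))) ⟩
    - sign (suc (suc a ℕ.+ b)) · + (k C n)  ≡⟨ cong (λ m → - sign m · + (k C n)) (sym (ℕ.+-suc (suc a) b)) ⟩
    - sign n · + (k C n)                    ≡⟨ sym (ℤ.neg-distribˡ-* (sign n) (+ (k C n))) ⟩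
    - [1-x]^ k n                            ∎
  binomial-vanishes : ¬ n ≤ k → - [1-x]^ k n ≡ + 0
  binomial-vanishes n≰k = begin
    - (sign n · + (k C n))    ≡⟨ cong (λ c → - (sign n · + c)) (k>n⇒nCk≡0 (ℕ.≰⇒> n≰k)) ⟩
    - (sign n · + 0)          ≡⟨ cong -_ (ℤ.*-zeroʳ (sign n)) ⟩
    + 0                       ∎

module _ (k : ℕ) where
  private
    E c : ℕ → ℤ
    E = geometric^ k
    c = [1-x]^ k

  -- The vanishing coefficient (E ⋆ c)(i + 1 + b) = 0, split after its first i + 2 terms.
  [1-x]^⋆geometric^-head : ∀ i b → ∑[ t < suc (suc i) ] (c t · E (suc i ℕ.+ b ∸ t))
                                   ≡ - ∑[ j < b ] (c (suc i ℕ.+ suc j) · E (b ∸ suc j))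
  [1-x]^⋆geometric^-head i b = inverseˡ-unique Head Tail (begin
    Head + Tail
      ≡⟨ cong (_+_ Head) (sym (∑-cong b tail-index)) ⟩
    Head + ∑[ j < b ] (c (suc (suc i) ℕ.+ j) · E (n ∸ (suc (suc i) ℕ.+ j)))
      ≡⟨ sym (∑-split (suc (suc i)) b (λ t → c t · E (n ∸ t))) ⟩
    (c ⋆ E) n        ≡⟨ ⋆-comm c E n ⟩
    (E ⋆ c) n        ≡⟨ geometric^⋆[1-x]^ k n ⟩
    + 0              ∎)
    where
    open ≡-Reasoning
    n : ℕ
    n = suc i ℕ.+ b
    Head Tail : ℤ
    Head = ∑[ t < suc (suc i) ] (c t · E (n ∸ t))
    Tail = ∑[ j < b ] (c (suc i ℕ.+ suc j) · E (b ∸ suc j))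
    tail-index : ∀ j → c (suc (suc i) ℕ.+ j) · E (n ∸ (suc (suc i) ℕ.+ j)) ≡ c (suc i ℕ.+ suc j) · E (b ∸ suc j)
    tail-index j = cong₂ (λ s r → c s · E r) (sym (ℕ.+-suc (suc i) j))
                         (trans (cong (n ∸_) (sym (ℕ.+-suc (suc i) j))) (ℕ.[m+n]∸[m+o]≡n∸o (suc i) b (suc j)))

  θval-column : ∀ b → (λ i → ∑[ j < suc b ] (E (b ∸ j) · θval k i j)) ≗ c ⋆ (E ∘ (b ℕ.+_))
  θval-column b zero = begin
    ∑[ j < suc b ] (E (b ∸ j) · θval k 0 j)
      ≡⟨ ∑-head b _ ⟩
    E b · + 1 + ∑[ j < b ] (E (b ∸ suc j) · + 0)
      ≡⟨ cong₂ _+_ (ℤ.*-identityʳ (E b)) (∑-zero b (λ j _ → ℤ.*-zeroʳ (E (b ∸ suc j)))) ⟩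
    E b + + 0
      ≡⟨ ℤ.+-comm (E b) (+ 0) ⟩
    + 0 + E b
      ≡⟨ cong (_+_ (+ 0)) (sym (ℤ.*-identityˡ (E b))) ⟩
    + 0 + + 1 · E b
      ≡⟨ cong (λ m → + 0 + + 1 · E m) (sym (ℕ.+-identityʳ b)) ⟩
    (c ⋆ (E ∘ (b ℕ.+_))) 0
      ∎
    where open ≡-Reasoning
  θval-column b (suc i) = begin
    ∑[ j < suc b ] (E (b ∸ j) · θval k (suc i) j)
      ≡⟨ ∑-head b _ ⟩
    E b · + 0 + ∑[ j < b ] (E (b ∸ suc j) · θval k (suc i) (suc j))
      ≡⟨ cong₂ _+_ (ℤ.*-zeroʳ (E b)) (∑-cong b (λ j → off-diagonal j)) ⟩
    + 0 + ∑[ j < b ] (- (c (suc i ℕ.+ suc j) · E (b ∸ suc j)))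
      ≡⟨ trans (ℤ.+-identityˡ _) (sym (∑-neg b _)) ⟩
    - ∑[ j < b ] (c (suc i ℕ.+ suc j) · E (b ∸ suc j))
      ≡⟨ sym ([1-x]^⋆geometric^-head i b) ⟩
    ∑[ t < suc (suc i) ] (c t · E (suc i ℕ.+ b ∸ t))
      ≡⟨ ∑-cong-< (suc (suc i)) (λ t t≤1+i → cong (λ m → c t · E m) (shift-∸ (ℕ.≤-pred t≤1+i))) ⟩
    (c ⋆ (E ∘ (b ℕ.+_))) (suc i)
      ∎
    where
    open ≡-Reasoning
    off-diagonal : ∀ j → E (b ∸ suc j) · θval k (suc i) (suc j) ≡ - (c (suc i ℕ.+ suc j) · E (b ∸ suc j))
    off-diagonal j = begin
      E (b ∸ suc j) · θval k (suc i) (suc j)     ≡⟨ cong (_·_ (E (b ∸ suc j))) (θval-suc-suc k i j) ⟩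
      E (b ∸ suc j) · - c (suc i ℕ.+ suc j)      ≡⟨ sym (ℤ.neg-distribʳ-* (E (b ∸ suc j)) (c (suc i ℕ.+ suc j))) ⟩
      - (E (b ∸ suc j) · c (suc i ℕ.+ suc j))    ≡⟨ cong -_ (ℤ.*-comm (E (b ∸ suc j)) (c (suc i ℕ.+ suc j))) ⟩
      - (c (suc i ℕ.+ suc j) · E (b ∸ suc j))    ∎
    shift-∸ : ∀ {t} → t ≤ suc i → suc i ℕ.+ b ∸ t ≡ b ℕ.+ (suc i ∸ t)
    shift-∸ t≤1+i = trans (ℕ.+-∸-comm b t≤1+i) (ℕ.+-comm _ b)

  θval-local : ∀ a b → ∑[ i < suc a ] ∑[ j < suc b ] (E (a ∸ i) · E (b ∸ j) · θval k i j) ≡ E (a ℕ.+ b)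
  θval-local a b = begin
    ∑[ i < suc a ] ∑[ j < suc b ] (E (a ∸ i) · E (b ∸ j) · θval k i j)
      ≡⟨ ∑-cong (suc a) (λ i → trans (∑-cong (suc b) (λ j → ℤ.*-assoc (E (a ∸ i)) _ _))
                                     (sym (∑-distribˡ-· (suc b) (E (a ∸ i)) _))) ⟩
    ∑[ i < suc a ] (E (a ∸ i) · column i)
      ≡⟨ ∑-cong (suc a) (λ i → trans (ℤ.*-comm (E (a ∸ i)) (column i)) (cong (_· E (a ∸ i)) (θval-column b i))) ⟩
    (c ⋆ shifted ⋆ E) a        ≡⟨ ⋆-comm (c ⋆ shifted) E a ⟩
    (E ⋆ (c ⋆ shifted)) a      ≡⟨ sym (⋆-assoc E c shifted a) ⟩
    (E ⋆ c ⋆ shifted) a        ≡⟨ ⋆-congˡ shifted (geometric^⋆[1-x]^ k) a ⟩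
    (δ ⋆ shifted) a            ≡⟨ ⋆-identityˡ shifted a ⟩
    E (b ℕ.+ a)                ≡⟨ cong E (ℕ.+-comm b a) ⟩
    E (a ℕ.+ b)                ∎
    where
    open ≡-Reasoning
    shifted : ℕ → ℤ
    shifted = E ∘ (b ℕ.+_)
    column : ℕ → ℤ
    column i = ∑[ j < suc b ] (E (b ∸ j) · θval k i j)

divisor-pos : ∀ {d n} → d ∣ n → 1 ≤ n → 1 ≤ d
divisor-pos {zero}  (divides q refl) 1≤n = ⊥-elim (ℕ.<⇒≱ 1≤n (ℕ.≤-reflexive (ℕ.*-zeroʳ q)))
divisor-pos {suc _} _                _   = s≤s z≤n

factor-∣ˡ : ∀ a b {n} → a * b ≡ n → a ∣ n
factor-∣ˡ a b ab≡n = divides b (trans (sym ab≡n) (ℕ.*-comm a b))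

factor-∣ʳ : ∀ a b {n} → a * b ≡ n → b ∣ n
factor-∣ʳ a b ab≡n = divides a (sym ab≡n)

factor-posˡ : ∀ a b {n} → a * b ≡ n → 1 ≤ n → 1 ≤ a
factor-posˡ a b ab≡n = divisor-pos (factor-∣ˡ a b ab≡n)

factor-posʳ : ∀ a b {n} → a * b ≡ n → 1 ≤ n → 1 ≤ b
factor-posʳ a b ab≡n = divisor-pos (factor-∣ʳ a b ab≡n)

coprime-divisors : ∀ {m n a b} → Coprime m n → a ∣ m → b ∣ n → Coprime a b
coprime-divisors coprime a∣m b∣n (i∣a , i∣b) = coprime (∣-trans i∣a a∣m , ∣-trans i∣b b∣n)

quotient-unique : ∀ a {n q} → suc a * q ≡ n → n / suc a ≡ q
quotient-unique a {q = q} refl = trans (cong (_/ suc a) (ℕ.*-comm (suc a) q)) (m*n/n≡m q (suc a))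

-- The factor of d dividing m is gcd d m.
∣-*-split : ∀ {d m n} → 1 ≤ m → d ∣ m * n → ∃₂ λ a b → a ∣ m × b ∣ n × a * b ≡ d
∣-*-split {d} {m} {n} 1≤m d∣mn = a , quotient a∣d , gcd[m,n]∣n d m , b∣n , sym (m∣n⇒n≡m*quotient a∣d)
  where
  a : ℕ
  a = gcd d m
  a∣d : a ∣ d
  a∣d = gcd[m,n]∣m d m
  instance
    a≢0 : NonZero a
    a≢0 = ℕ.≢-nonZero (gcd[m,n]≢0 d m (inj₂ (ℕ.≢-nonZero⁻¹ m {{ℕ.>-nonZero 1≤m}})))
  d∣na : d ∣ n * a
  d∣na = subst (d ∣_) (sym (c*gcd[m,n]≡gcd[cm,cn] n d m))
               (gcd-greatest (∣n⇒∣m*n n ∣-refl) (subst (d ∣_) (ℕ.*-comm m n) d∣mn))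
  b∣n : quotient a∣d ∣ n
  b∣n = *-cancelˡ-∣ a (subst₂ _∣_ (m∣n⇒n≡m*quotient a∣d) (ℕ.*-comm n a) d∣na)

∣-*-split-unique : ∀ {m n a b a′ b′} → Coprime m n → a ∣ m → b ∣ n → a′ ∣ m → b′ ∣ n →
  a * b ≡ a′ * b′ → a ≡ a′
∣-*-split-unique {a = a} {b} {a′} {b′} coprime a∣m b∣n a′∣m b′∣n ab≡a′b′ = ∣-antisym a∣a′ a′∣a
  where
  a∣a′ : a ∣ a′
  a∣a′ = coprime-divisor (coprime-divisors coprime a∣m b′∣n)
           (subst (a ∣_) (trans ab≡a′b′ (ℕ.*-comm a′ b′)) (m∣m*n b))
  a′∣a : a′ ∣ a
  a′∣a = coprime-divisor (coprime-divisors coprime a′∣m b∣n)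
           (subst (a′ ∣_) (trans (sym ab≡a′b′) (ℕ.*-comm a b)) (m∣m*n b′))

cofactor-* : ∀ {a b c m n} → suc a ∣ m → suc b ∣ n → suc a * suc b ≡ suc c →
  m * n / suc c ≡ (m / suc a) * (n / suc b)
cofactor-* {a} {b} {c} {m} {n} a∣m b∣n ab≡c = quotient-unique c (begin
  suc c * ((m / suc a) * (n / suc b))
    ≡⟨ cong (_* ((m / suc a) * (n / suc b))) (sym ab≡c) ⟩
  suc a * suc b * ((m / suc a) * (n / suc b))
    ≡⟨ ℕ.[m*n]*[o*p]≡[m*o]*[n*p] (suc a) (suc b) (m / suc a) (n / suc b) ⟩
  suc a * (m / suc a) * (suc b * (n / suc b))
    ≡⟨ cong₂ _*_ (m*[n/m]≡n a∣m) (m*[n/m]≡n b∣n) ⟩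
  m * n
    ∎)
  where open ≡-Reasoning

-- Sums over factorisations

guard : {P : Set} → Dec P → ℤ → ℤ
guard P? x = if does P? then x else + 0

guard-yes : ∀ {P : Set} (P? : Dec P) {x} → P → guard P? x ≡ x
guard-yes (yes _) _ = refl
guard-yes (no ¬p) p = ⊥-elim (¬p p)

guard-no : ∀ {P : Set} (P? : Dec P) {x} → ¬ P → guard P? x ≡ + 0
guard-no (yes p) ¬p = ⊥-elim (¬p p)
guard-no (no _)  _  = refl

guard-cong : ∀ {P : Set} (P? : Dec P) {x y} → (P → x ≡ y) → guard P? x ≡ guard P? y
guard-cong (yes p) x≡y = x≡y p
guard-cong (no _)  _   = refl

guard-∑ : ∀ {P : Set} (P? : Dec P) n (f : ℕ → ℤ) → guard P? (∑< n f) ≡ ∑[ i < n ] guard P? (f i)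
guard-∑ (yes _) n f = refl
guard-∑ (no _)  n f = sym (∑-zero n (λ _ _ → refl))

guard-·ˡ : ∀ {P : Set} (P? : Dec P) x y → x · guard P? y ≡ guard P? (x · y)
guard-·ˡ (yes _) x y = refl
guard-·ˡ (no _)  x y = ℤ.*-zeroʳ x

guard-·ʳ : ∀ {P : Set} (P? : Dec P) x y → guard P? x · y ≡ guard P? (x · y)
guard-·ʳ (yes _) x y = refl
guard-·ʳ (no _)  x y = refl

guard-guard : ∀ {P Q : Set} (P? : Dec P) (Q? : Dec Q) x → guard P? (guard Q? x) ≡ guard (P? ×-dec Q?) x
guard-guard (yes _) Q? x = refl
guard-guard (no _)  Q? x = refl

∑∣ : ℕ → (ℕ → ℕ → ℤ) → ℤ
∑∣ n F = ∑[ i < n ] guard (suc i ∣? n) (F (suc i) (n / suc i))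

infixl 10 ∑∣
syntax ∑∣ n (λ a b → e) = ∑[ a * b ≡ n ] e

∑∣-cong : ∀ n {F G : ℕ → ℕ → ℤ} → (∀ a b → a * b ≡ n → F a b ≡ G a b) → ∑∣ n F ≡ ∑∣ n G
∑∣-cong n F≡G = ∑-cong n (λ i → guard-cong (suc i ∣? n) (λ i+1∣n → F≡G (suc i) (n / suc i) (m*[n/m]≡n i+1∣n)))

∑∣-·-∑∣ : ∀ m n F G → ∑∣ m F · ∑∣ n G ≡ ∑[ a * a′ ≡ m ] ∑[ b * b′ ≡ n ] (F a a′ · G b b′)
∑∣-·-∑∣ m n F G = trans (∑-distribʳ-· m (∑∣ n G) _) (∑-cong m λ i →
  trans (guard-·ʳ (suc i ∣? m) _ (∑∣ n G)) (guard-cong (suc i ∣? m) λ _ →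
  trans (∑-distribˡ-· n (F (suc i) (m / suc i)) _)
        (∑-cong n λ j → guard-·ˡ (suc j ∣? n) (F (suc i) (m / suc i)) (G (suc j) (n / suc j)))))

∑-guard-≟ : ∀ N c v → 1 ≤ c → c ≤ N → ∑[ i < N ] guard (c ℕ.≟ suc i) v ≡ v
∑-guard-≟ N (suc w) v _ c≤N = trans
  (∑-select N w _ c≤N (λ i _ i≢w → guard-no (suc w ℕ.≟ suc i) (λ w+1≡i+1 → i≢w (sym (ℕ.suc-injective w+1≡i+1)))))
  (guard-yes (suc w ℕ.≟ suc w) refl)

module _ (m n : ℕ) (F : ℕ → ℕ → ℤ) (1≤m : 1 ≤ m) (1≤n : 1 ≤ n) (coprime : Coprime m n) where
  private
    N : ℕ
    N = m * n

    term : ℕ → ℕ → ℤ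
    term x y = F (suc x * suc y) ((m / suc x) * (n / suc y))

    splits? : ∀ x y i → Dec ((suc x ∣ m × suc y ∣ n) × suc x * suc y ≡ suc i)
    splits? x y i = (suc x ∣? m ×-dec suc y ∣? n) ×-dec (suc x * suc y ℕ.≟ suc i)

    expand : ∀ x → guard (suc x ∣? m) (∑[ y < n ] guard (suc y ∣? n) (term x y))
                 ≡ ∑[ y < n ] ∑[ i < N ] guard (splits? x y i) (term x y)
    expand x = trans (guard-∑ (suc x ∣? m) n _) (∑-cong n λ y → begin
      guard (suc x ∣? m) (guard (suc y ∣? n) (term x y))
        ≡⟨ guard-guard (suc x ∣? m) (suc y ∣? n) _ ⟩
      guard (suc x ∣? m ×-dec suc y ∣? n) (term x y)
        ≡⟨ guard-cong (suc x ∣? m ×-dec suc y ∣? n) (λ (x∣m , y∣n) →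
             sym (∑-guard-≟ N (suc x * suc y) (term x y) (s≤s z≤n)
                    (∣⇒≤ {{ℕ.>-nonZero (ℕ.*-mono-≤ 1≤m 1≤n)}} (*-pres-∣ x∣m y∣n)))) ⟩
      guard (suc x ∣? m ×-dec suc y ∣? n) (∑[ i < N ] guard (suc x * suc y ℕ.≟ suc i) (term x y))
        ≡⟨ guard-∑ (suc x ∣? m ×-dec suc y ∣? n) N _ ⟩
      ∑[ i < N ] guard (suc x ∣? m ×-dec suc y ∣? n) (guard (suc x * suc y ℕ.≟ suc i) (term x y))
        ≡⟨ ∑-cong N (λ i → guard-guard (suc x ∣? m ×-dec suc y ∣? n) (suc x * suc y ℕ.≟ suc i) _) ⟩
      ∑[ i < N ] guard (splits? x y i) (term x y)
        ∎)
      where open ≡-Reasoning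

    -- Since m and n are coprime, each divisor of m * n splits in exactly one way.
    collect : ∀ i (i+1∣?N : Dec (suc i ∣ N)) → ∑[ x < m ] ∑[ y < n ] guard (splits? x y i) (term x y)
                                              ≡ guard i+1∣?N (F (suc i) (N / suc i))
    collect i (no ¬i+1∣N) = ∑-zero m λ x _ → ∑-zero n λ y _ → guard-no (splits? x y i)
            λ ((x∣m , y∣n) , xy≡i+1) → ¬i+1∣N (subst (_∣ N) xy≡i+1 (*-pres-∣ x∣m y∣n))
    collect i (yes i+1∣N) with ∣-*-split 1≤m i+1∣N
    ...   | zero , _ , _ , _ , ab≡i+1 = ⊥-elim (ℕ.0≢1+n ab≡i+1)
    ...   | suc x₀ , zero , _ , _ , ab≡i+1 = ⊥-elim (ℕ.0≢1+n (trans (sym (ℕ.*-zeroʳ (suc x₀))) ab≡i+1))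
    ...   | suc x₀ , suc y₀ , x₀∣m , y₀∣n , ab≡i+1 = begin
      ∑[ x < m ] ∑[ y < n ] guard (splits? x y i) (term x y)
        ≡⟨ ∑-select m x₀ _ (∣⇒≤ {{ℕ.>-nonZero 1≤m}} x₀∣m) (λ x _ x≢x₀ → ∑-zero n λ y _ →
             guard-no (splits? x y i) λ ((x∣m , y∣n) , xy≡i+1) →
               x≢x₀ (ℕ.suc-injective (∣-*-split-unique coprime x∣m y∣n x₀∣m y₀∣n (trans xy≡i+1 (sym ab≡i+1))))) ⟩
      ∑[ y < n ] guard (splits? x₀ y i) (term x₀ y)
        ≡⟨ ∑-select n y₀ _ (∣⇒≤ {{ℕ.>-nonZero 1≤n}} y₀∣n) (λ y _ y≢y₀ →
             guard-no (splits? x₀ y i) λ (_ , x₀y≡i+1) →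
               y≢y₀ (ℕ.suc-injective (ℕ.*-cancelˡ-≡ (suc y) (suc y₀) (suc x₀) (trans x₀y≡i+1 (sym ab≡i+1))))) ⟩
      guard (splits? x₀ y₀ i) (term x₀ y₀)
        ≡⟨ guard-yes (splits? x₀ y₀ i) ((x₀∣m , y₀∣n) , ab≡i+1) ⟩
      F (suc x₀ * suc y₀) ((m / suc x₀) * (n / suc y₀))
        ≡⟨ cong₂ F ab≡i+1 (sym (cofactor-* x₀∣m y₀∣n ab≡i+1)) ⟩
      F (suc i) (N / suc i)
        ∎
      where open ≡-Reasoning

  ∑∣-coprime : ∑∣ (m * n) F ≡ ∑[ a * a′ ≡ m ] ∑[ b * b′ ≡ n ] F (a * b) (a′ * b′)
  ∑∣-coprime = sym (begin
    ∑[ x < m ] guard (suc x ∣? m) (∑[ y < n ] guard (suc y ∣? n) (term x y))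
      ≡⟨ ∑-cong m expand ⟩
    ∑[ x < m ] ∑[ y < n ] ∑[ i < N ] guard (splits? x y i) (term x y)
      ≡⟨ ∑-cong m (λ x → ∑-comm n N _) ⟩
    ∑[ x < m ] ∑[ i < N ] ∑[ y < n ] guard (splits? x y i) (term x y)
      ≡⟨ ∑-comm m N _ ⟩
    ∑[ i < N ] ∑[ x < m ] ∑[ y < n ] guard (splits? x y i) (term x y)
      ≡⟨ ∑-cong N (λ i → collect i (suc i ∣? N)) ⟩
    ∑∣ N F
      ∎)
    where open ≡-Reasoning

prime-divisor : ∀ {n} → 1 < n → ∃ λ p → Prime p × p ∣ n
prime-divisor {n} 1<n with factorise n {{ℕ.>-nonZero (ℕ.<-trans (s≤s z≤n) 1<n)}}
... | record { factors = [] ; isFactorisation = n≡1 } = ⊥-elim (ℕ.<⇒≢ 1<n (sym n≡1))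
... | record { factors = p ∷ ps ; isFactorisation = n≡p*∏ps ; factorsPrime = p-prime ∷ _ } =
  p , p-prime , divides (product ps) (trans n≡p*∏ps (ℕ.*-comm p (product ps)))

module _ {p : ℕ} (p-prime : Prime p) where
  private instance
    p≢0 : NonZero p
    p≢0 = prime⇒nonZero p-prime

  prime>1 : 1 < p
  prime>1 = ℕ.nonTrivial⇒n>1 p {{prime⇒nonTrivial p-prime}}

  ^-injectiveʳ : ∀ {i j} → p ^ i ≡ p ^ j → i ≡ j
  ^-injectiveʳ {i} {j} pⁱ≡pʲ with ℕ.<-cmp i j
  ... | tri< i<j _ _ = ⊥-elim (ℕ.<⇒≢ (ℕ.^-monoʳ-< p prime>1 i<j) pⁱ≡pʲ)
  ... | tri≈ _ i≡j _ = i≡j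
  ... | tri> _ _ i>j = ⊥-elim (ℕ.<⇒≢ (ℕ.^-monoʳ-< p prime>1 i>j) (sym pⁱ≡pʲ))

  ^-∸-split : ∀ {i e} → i ≤ e → p ^ i * p ^ (e ∸ i) ≡ p ^ e
  ^-∸-split {i} {e} i≤e = trans (sym (ℕ.^-distribˡ-+-* p i (e ∸ i))) (cong (p ^_) (ℕ.m+[n∸m]≡n i≤e))

  coprime-prime : ∀ {m} → ¬ p ∣ m → Coprime p m
  coprime-prime ¬p∣m (c∣p , c∣m) with prime⇒irreducible p-prime c∣p
  ... | inj₁ c≡1 = c≡1
  ... | inj₂ refl = ⊥-elim (¬p∣m c∣m)

  ∣p^⇒≡p^ : ∀ e {d} → d ∣ p ^ e → ∃ λ j → j ≤ e × d ≡ p ^ j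
  ∣p^⇒≡p^ zero    d∣1 = 0 , z≤n , ∣1⇒≡1 d∣1
  ∣p^⇒≡p^ (suc e) {d} d∣p^e+1 with p ∣? d
  ... | yes (divides q refl) with ∣p^⇒≡p^ e (*-cancelˡ-∣ p (subst (_∣ p * p ^ e) (ℕ.*-comm q p) d∣p^e+1))
  ...   | j , j≤e , q≡pʲ = suc j , s≤s j≤e , trans (ℕ.*-comm q p) (cong (p *_) q≡pʲ)
  ∣p^⇒≡p^ (suc e) {d} d∣p^e+1 | no ¬p∣d with ∣p^⇒≡p^ e (coprime-divisor (Coprime.sym (coprime-prime ¬p∣d)) d∣p^e+1)
  ...   | j , j≤e , d≡pʲ = j , ℕ.m≤n⇒m≤1+n j≤e , d≡pʲ

  prime∤-* : ∀ {m n} → ¬ p ∣ m → ¬ p ∣ n → ¬ p ∣ m * n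
  prime∤-* {m} {n} ¬p∣m ¬p∣n p∣mn with euclidsLemma m n p-prime p∣mn
  ... | inj₁ p∣m = ¬p∣m p∣m
  ... | inj₂ p∣n = ¬p∣n p∣n

  prime-power-split : ∀ n → 1 ≤ n → ∃₂ λ e m → ¬ p ∣ m × n ≡ p ^ e * m
  prime-power-split = <-rec _ split
    where
    split : ∀ n → (∀ {k} → k < n → 1 ≤ k → ∃₂ λ e m → ¬ p ∣ m × k ≡ p ^ e * m) →
            1 ≤ n → ∃₂ λ e m → ¬ p ∣ m × n ≡ p ^ e * m
    split n rec 1≤n with p ∣? n
    ... | no ¬p∣n = 0 , n , ¬p∣n , sym (ℕ.*-identityˡ n)
    ... | yes (divides q refl) with rec (ℕ.m<m*n q p {{ℕ.>-nonZero 1≤q}} prime>1) 1≤q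
      where
      1≤q : 1 ≤ q
      1≤q = factor-posˡ q p refl 1≤n
    ...   | e , m , ¬p∣m , refl = suc e , m , ¬p∣m ,
              trans (ℕ.*-comm (p ^ e * m) p) (sym (ℕ.*-assoc p (p ^ e) m))

  <-p^-* : ∀ e {m} → 1 ≤ m → ¬ p ∣ m → p ∣ p ^ e * m → m < p ^ e * m
  <-p^-* zero    {m} _   ¬p∣m p∣m = ⊥-elim (¬p∣m (subst (p ∣_) (ℕ.*-identityˡ m) p∣m))
  <-p^-* (suc e) {m} 1≤m _    _   = subst (m <_) (ℕ.*-comm m (p ^ suc e))
    (ℕ.m<m*n m (p ^ suc e) {{ℕ.>-nonZero 1≤m}} (ℕ.^-monoʳ-< p prime>1 {0} {suc e} (s≤s z≤n)))

  coprime-^ : ∀ {m} → ¬ p ∣ m → ∀ e → Coprime (p ^ e) m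
  coprime-^ ¬p∣m e (c∣p^e , c∣m) with ∣p^⇒≡p^ e c∣p^e
  ... | zero  , _ , c≡1    = c≡1
  ... | suc j , _ , refl   = ⊥-elim (¬p∣m (∣-trans (m∣m*n (p ^ j)) c∣m))

  ∑∣-prime^ : ∀ e F → ∑∣ (p ^ e) F ≡ ∑[ i < suc e ] F (p ^ i) (p ^ (e ∸ i))
  ∑∣-prime^ e F = begin
    ∑[ x < p ^ e ] guard (suc x ∣? p ^ e) (F (suc x) (p ^ e / suc x))
      ≡⟨ ∑-cong (p ^ e) (λ x → sym (as-powers x (suc x ∣? p ^ e))) ⟩
    ∑[ x < p ^ e ] ∑[ i < suc e ] guard (p ^ i ℕ.≟ suc x) (term i)
      ≡⟨ ∑-comm (p ^ e) (suc e) _ ⟩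
    ∑[ i < suc e ] ∑[ x < p ^ e ] guard (p ^ i ℕ.≟ suc x) (term i)
      ≡⟨ ∑-cong-< (suc e) (λ i i≤e → ∑-guard-≟ (p ^ e) (p ^ i) (term i) (ℕ.m^n>0 p i) (ℕ.^-monoʳ-≤ p (ℕ.≤-pred i≤e))) ⟩
    ∑[ i < suc e ] term i
      ∎
    where
    open ≡-Reasoning
    term : ℕ → ℤ
    term i = F (p ^ i) (p ^ (e ∸ i))
    as-powers : ∀ x (x+1∣?p^e : Dec (suc x ∣ p ^ e)) →
      ∑[ i < suc e ] guard (p ^ i ℕ.≟ suc x) (term i) ≡ guard x+1∣?p^e (F (suc x) (p ^ e / suc x))
    as-powers x (no ¬x+1∣p^e) = ∑-zero (suc e) λ i i≤e → guard-no (p ^ i ℕ.≟ suc x)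
      λ pⁱ≡x+1 → ¬x+1∣p^e (divides (p ^ (e ∸ i)) (trans (sym (^-∸-split (ℕ.≤-pred i≤e)))
                                                         (trans (ℕ.*-comm (p ^ i) _) (cong (p ^ (e ∸ i) *_) pⁱ≡x+1))))
    as-powers x (yes x+1∣p^e) with ∣p^⇒≡p^ e x+1∣p^e
    ... | j , j≤e , x+1≡pʲ = begin
      ∑[ i < suc e ] guard (p ^ i ℕ.≟ suc x) (term i)
        ≡⟨ ∑-select (suc e) j _ (s≤s j≤e) (λ i _ i≢j →
             guard-no (p ^ i ℕ.≟ suc x) (λ pⁱ≡x+1 → i≢j (^-injectiveʳ (trans pⁱ≡x+1 x+1≡pʲ)))) ⟩
      guard (p ^ j ℕ.≟ suc x) (term j)
        ≡⟨ guard-yes (p ^ j ℕ.≟ suc x) (sym x+1≡pʲ) ⟩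
      F (p ^ j) (p ^ (e ∸ j))
        ≡⟨ cong₂ F (sym x+1≡pʲ) (sym (quotient-unique x (trans (cong (_* p ^ (e ∸ j)) x+1≡pʲ) (^-∸-split j≤e)))) ⟩
      F (suc x) (p ^ e / suc x)
        ∎

-- Multiplicative functions

Multiplicative : (ℕ → ℤ) → Set
Multiplicative f = ∀ {m n} → 1 ≤ m → 1 ≤ n → Coprime m n → f (m * n) ≡ f m · f n

Multiplicative₂ : (ℕ → ℕ → ℤ) → Set
Multiplicative₂ F = ∀ {m₁ m₂ n₁ n₂} → 1 ≤ m₁ → 1 ≤ m₂ → 1 ≤ n₁ → 1 ≤ n₂ →
  Coprime (m₁ * m₂) (n₁ * n₂) → F (m₁ * n₁) (m₂ * n₂) ≡ F m₁ m₂ · F n₁ n₂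

isMultiplicative₂⇒multiplicative₂ : ∀ {F} → IsMultiplicative₂ F → Multiplicative₂ F
isMultiplicative₂⇒multiplicative₂ (_ , mult) {suc _} {suc _} {suc _} {suc _} _ _ _ _ = mult _ _ _ _

multiplicative-∘* : ∀ {f} → Multiplicative f → Multiplicative₂ (λ m n → f (m * n))
multiplicative-∘* {f} mult {m₁} {m₂} {n₁} {n₂} 1≤m₁ 1≤m₂ 1≤n₁ 1≤n₂ coprime = begin
  f (m₁ * n₁ * (m₂ * n₂))    ≡⟨ cong f (ℕ.[m*n]*[o*p]≡[m*o]*[n*p] m₁ n₁ m₂ n₂) ⟩
  f (m₁ * m₂ * (n₁ * n₂))    ≡⟨ mult (ℕ.*-mono-≤ 1≤m₁ 1≤m₂) (ℕ.*-mono-≤ 1≤n₁ 1≤n₂) coprime ⟩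
  f (m₁ * m₂) · f (n₁ * n₂)    ∎
  where open ≡-Reasoning

_⊗_ : (ℕ → ℤ) → (ℕ → ℤ) → ℕ → ℕ → ℤ
(f ⊗ g) m n = f m · g n

⊗-multiplicative : ∀ {f g} → Multiplicative f → Multiplicative g → Multiplicative₂ (f ⊗ g)
⊗-multiplicative {f} {g} f-mult g-mult {m₁} {m₂} {n₁} {n₂} 1≤m₁ 1≤m₂ 1≤n₁ 1≤n₂ coprime = begin
  f (m₁ * n₁) · g (m₂ * n₂)
    ≡⟨ cong₂ _·_ (f-mult 1≤m₁ 1≤n₁ (coprime-divisors coprime (m∣m*n m₂) (m∣m*n n₂)))
                 (g-mult 1≤m₂ 1≤n₂ (coprime-divisors coprime (n∣m*n m₁) (n∣m*n n₁))) ⟩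
  f m₁ · f n₁ · (g m₂ · g n₂)
    ≡⟨ ·-interchange (f m₁) (f n₁) (g m₂) (g n₂) ⟩
  f m₁ · g m₂ · (f n₁ · g n₂)
    ∎
  where open ≡-Reasoning

infixl 7 _∗_ _⊛_

_∗_ : (ℕ → ℤ) → (ℕ → ℤ) → ℕ → ℤ
(f ∗ g) n = ∑[ a * b ≡ n ] (f a · g b)

_⊛_ : (ℕ → ℕ → ℤ) → (ℕ → ℕ → ℤ) → ℕ → ℕ → ℤ
(F ⊛ G) n₁ n₂ = ∑[ a₁ * b₁ ≡ n₁ ] ∑[ a₂ * b₂ ≡ n₂ ] (F a₁ a₂ · G b₁ b₂)

∗-multiplicative : ∀ {f g} → Multiplicative f → Multiplicative g → Multiplicative (f ∗ g)
∗-multiplicative {f} {g} f-mult g-mult {m} {n} 1≤m 1≤n coprime = begin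
  ∑[ c * c′ ≡ m * n ] (f c · g c′)
    ≡⟨ ∑∣-coprime m n (λ c c′ → f c · g c′) 1≤m 1≤n coprime ⟩
  ∑[ a * a′ ≡ m ] ∑[ b * b′ ≡ n ] (f (a * b) · g (a′ * b′))
    ≡⟨ ∑∣-cong m (λ a a′ aa′≡m → ∑∣-cong n (λ b b′ bb′≡n → split a a′ b b′ aa′≡m bb′≡n)) ⟩
  ∑[ a * a′ ≡ m ] ∑[ b * b′ ≡ n ] (f a · g a′ · (f b · g b′))
    ≡⟨ sym (∑∣-·-∑∣ m n (λ a a′ → f a · g a′) (λ b b′ → f b · g b′)) ⟩
  (f ∗ g) m · (f ∗ g) n
    ∎
  where
  open ≡-Reasoning
  split : ∀ a a′ b b′ → a * a′ ≡ m → b * b′ ≡ n →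
    f (a * b) · g (a′ * b′) ≡ f a · g a′ · (f b · g b′)
  split a a′ b b′ aa′≡m bb′≡n = ⊗-multiplicative {f} {g} f-mult g-mult
    (factor-posˡ a a′ aa′≡m 1≤m) (factor-posʳ a a′ aa′≡m 1≤m) (factor-posˡ b b′ bb′≡n 1≤n) (factor-posʳ b b′ bb′≡n 1≤n)
    (subst₂ Coprime (sym aa′≡m) (sym bb′≡n) coprime)

⊛-multiplicative : ∀ {F G} → Multiplicative₂ F → Multiplicative₂ G → Multiplicative₂ (F ⊛ G)
⊛-multiplicative {F} {G} F-mult G-mult {m₁} {m₂} {n₁} {n₂} 1≤m₁ 1≤m₂ 1≤n₁ 1≤n₂ coprime = begin
  ∑[ c₁ * c₁′ ≡ m₁ * n₁ ] ∑[ c₂ * c₂′ ≡ m₂ * n₂ ] (F c₁ c₂ · G c₁′ c₂′)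
    ≡⟨ ∑∣-coprime m₁ n₁ (λ c₁ c₁′ → ∑[ c₂ * c₂′ ≡ m₂ * n₂ ] (F c₁ c₂ · G c₁′ c₂′)) 1≤m₁ 1≤n₁ coprime₁ ⟩
  ∑[ a₁ * a₁′ ≡ m₁ ] ∑[ b₁ * b₁′ ≡ n₁ ] ∑[ c₂ * c₂′ ≡ m₂ * n₂ ] (F (a₁ * b₁) c₂ · G (a₁′ * b₁′) c₂′)
    ≡⟨ ∑∣-cong m₁ (λ a₁ a₁′ _ → ∑∣-cong n₁ (λ b₁ b₁′ _ →
         ∑∣-coprime m₂ n₂ (λ c₂ c₂′ → F (a₁ * b₁) c₂ · G (a₁′ * b₁′) c₂′) 1≤m₂ 1≤n₂ coprime₂)) ⟩
  ∑[ a₁ * a₁′ ≡ m₁ ] ∑[ b₁ * b₁′ ≡ n₁ ] ∑[ a₂ * a₂′ ≡ m₂ ] ∑[ b₂ * b₂′ ≡ n₂ ]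
    (F (a₁ * b₁) (a₂ * b₂) · G (a₁′ * b₁′) (a₂′ * b₂′))
    ≡⟨ ∑∣-cong m₁ (λ a₁ a₁′ eq₁ → ∑∣-cong n₁ (λ b₁ b₁′ eq₂ → ∑∣-cong m₂ (λ a₂ a₂′ eq₃ →
         ∑∣-cong n₂ (λ b₂ b₂′ eq₄ → split a₁ a₁′ b₁ b₁′ a₂ a₂′ b₂ b₂′ eq₁ eq₂ eq₃ eq₄)))) ⟩
  ∑[ a₁ * a₁′ ≡ m₁ ] ∑[ b₁ * b₁′ ≡ n₁ ] ∑[ a₂ * a₂′ ≡ m₂ ] ∑[ b₂ * b₂′ ≡ n₂ ]
    (F a₁ a₂ · G a₁′ a₂′ · (F b₁ b₂ · G b₁′ b₂′))
    ≡⟨ sym (∑∣-cong m₁ (λ a₁ a₁′ _ → ∑∣-cong n₁ (λ b₁ b₁′ _ →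
         ∑∣-·-∑∣ m₂ n₂ (λ a₂ a₂′ → F a₁ a₂ · G a₁′ a₂′) (λ b₂ b₂′ → F b₁ b₂ · G b₁′ b₂′)))) ⟩
  ∑[ a₁ * a₁′ ≡ m₁ ] ∑[ b₁ * b₁′ ≡ n₁ ]
    (∑[ a₂ * a₂′ ≡ m₂ ] (F a₁ a₂ · G a₁′ a₂′) · ∑[ b₂ * b₂′ ≡ n₂ ] (F b₁ b₂ · G b₁′ b₂′))
    ≡⟨ sym (∑∣-·-∑∣ m₁ n₁ (λ a₁ a₁′ → ∑[ a₂ * a₂′ ≡ m₂ ] (F a₁ a₂ · G a₁′ a₂′))
                           (λ b₁ b₁′ → ∑[ b₂ * b₂′ ≡ n₂ ] (F b₁ b₂ · G b₁′ b₂′))) ⟩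
  (F ⊛ G) m₁ m₂ · (F ⊛ G) n₁ n₂
    ∎
  where
  open ≡-Reasoning
  coprime₁ : Coprime m₁ n₁
  coprime₁ = coprime-divisors coprime (m∣m*n m₂) (m∣m*n n₂)
  coprime₂ : Coprime m₂ n₂
  coprime₂ = coprime-divisors coprime (n∣m*n m₁) (n∣m*n n₁)
  split : ∀ a₁ a₁′ b₁ b₁′ a₂ a₂′ b₂ b₂′ → a₁ * a₁′ ≡ m₁ → b₁ * b₁′ ≡ n₁ → a₂ * a₂′ ≡ m₂ → b₂ * b₂′ ≡ n₂ →
    F (a₁ * b₁) (a₂ * b₂) · G (a₁′ * b₁′) (a₂′ * b₂′) ≡ F a₁ a₂ · G a₁′ a₂′ · (F b₁ b₂ · G b₁′ b₂′)
  split a₁ a₁′ b₁ b₁′ a₂ a₂′ b₂ b₂′ eq₁ eq₂ eq₃ eq₄ = begin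
    F (a₁ * b₁) (a₂ * b₂) · G (a₁′ * b₁′) (a₂′ * b₂′)
      ≡⟨ cong₂ _·_
           (F-mult (divisor-pos a₁∣m₁ 1≤m₁) (divisor-pos a₂∣m₂ 1≤m₂) (divisor-pos b₁∣n₁ 1≤n₁) (divisor-pos b₂∣n₂ 1≤n₂)
                   (coprime-divisors coprime (*-pres-∣ a₁∣m₁ a₂∣m₂) (*-pres-∣ b₁∣n₁ b₂∣n₂)))
           (G-mult (divisor-pos a₁′∣m₁ 1≤m₁) (divisor-pos a₂′∣m₂ 1≤m₂) (divisor-pos b₁′∣n₁ 1≤n₁) (divisor-pos b₂′∣n₂ 1≤n₂)
                   (coprime-divisors coprime (*-pres-∣ a₁′∣m₁ a₂′∣m₂) (*-pres-∣ b₁′∣n₁ b₂′∣n₂))) ⟩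
    F a₁ a₂ · F b₁ b₂ · (G a₁′ a₂′ · G b₁′ b₂′)
      ≡⟨ ·-interchange (F a₁ a₂) (F b₁ b₂) (G a₁′ a₂′) (G b₁′ b₂′) ⟩
    F a₁ a₂ · G a₁′ a₂′ · (F b₁ b₂ · G b₁′ b₂′)
      ∎
    where
    a₁∣m₁ : a₁ ∣ m₁
    a₁∣m₁ = factor-∣ˡ a₁ a₁′ eq₁
    a₁′∣m₁ : a₁′ ∣ m₁
    a₁′∣m₁ = factor-∣ʳ a₁ a₁′ eq₁
    b₁∣n₁ : b₁ ∣ n₁
    b₁∣n₁ = factor-∣ˡ b₁ b₁′ eq₂
    b₁′∣n₁ : b₁′ ∣ n₁
    b₁′∣n₁ = factor-∣ʳ b₁ b₁′ eq₂
    a₂∣m₂ : a₂ ∣ m₂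
    a₂∣m₂ = factor-∣ˡ a₂ a₂′ eq₃
    a₂′∣m₂ : a₂′ ∣ m₂
    a₂′∣m₂ = factor-∣ʳ a₂ a₂′ eq₃
    b₂∣n₂ : b₂ ∣ n₂
    b₂∣n₂ = factor-∣ˡ b₂ b₂′ eq₄
    b₂′∣n₂ : b₂′ ∣ n₂
    b₂′∣n₂ = factor-∣ʳ b₂ b₂′ eq₄

multiplicative₂-unique : ∀ {F G} → Multiplicative₂ F → Multiplicative₂ G →
  (∀ p a b → Prime p → F (p ^ a) (p ^ b) ≡ G (p ^ a) (p ^ b)) →
  ∀ {n₁ n₂} → 1 ≤ n₁ → 1 ≤ n₂ → F n₁ n₂ ≡ G n₁ n₂
multiplicative₂-unique {F} {G} F-mult G-mult agree {n₁} {n₂} = <-rec P step (n₁ * n₂) refl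
  where
  P : ℕ → Set
  P N = ∀ {n₁ n₂} → n₁ * n₂ ≡ N → 1 ≤ n₁ → 1 ≤ n₂ → F n₁ n₂ ≡ G n₁ n₂
  step : ∀ N → (∀ {M} → M < N → P M) → P N
  step _ rec {n₁} {n₂} refl 1≤n₁ 1≤n₂ with ℕ.m≤n⇒m<n∨m≡n (ℕ.*-mono-≤ 1≤n₁ 1≤n₂)
  -- F 1 1 ≡ G 1 1 is the instance p ^ 0 of the agreement on prime powers.
  ... | inj₂ 1≡n₁n₂ = subst₂ (λ x y → F x y ≡ G x y)
                        (sym (ℕ.m*n≡1⇒m≡1 n₁ n₂ (sym 1≡n₁n₂))) (sym (ℕ.m*n≡1⇒n≡1 n₁ n₂ (sym 1≡n₁n₂)))
                        (agree 2 0 0 prime[2])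
  ... | inj₁ 1<n₁n₂ with prime-divisor 1<n₁n₂
  ...   | p , p-prime , p∣n₁n₂ with prime-power-split p-prime n₁ 1≤n₁ | prime-power-split p-prime n₂ 1≤n₂
  ...     | a , m₁ , ¬p∣m₁ , refl | b , m₂ , ¬p∣m₂ , refl = begin
    F (p ^ a * m₁) (p ^ b * m₂)    ≡⟨ F-mult 1≤pᵃ 1≤pᵇ 1≤m₁ 1≤m₂ coprime ⟩
    F (p ^ a) (p ^ b) · F m₁ m₂    ≡⟨ cong₂ _·_ (agree p a b p-prime) (rec smaller refl 1≤m₁ 1≤m₂) ⟩
    G (p ^ a) (p ^ b) · G m₁ m₂    ≡⟨ sym (G-mult 1≤pᵃ 1≤pᵇ 1≤m₁ 1≤m₂ coprime) ⟩
    G (p ^ a * m₁) (p ^ b * m₂)    ∎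
    where
    open ≡-Reasoning
    1≤pᵃ : 1 ≤ p ^ a
    1≤pᵃ = factor-posˡ (p ^ a) m₁ refl 1≤n₁
    1≤pᵇ : 1 ≤ p ^ b
    1≤pᵇ = factor-posˡ (p ^ b) m₂ refl 1≤n₂
    1≤m₁ : 1 ≤ m₁
    1≤m₁ = factor-posʳ (p ^ a) m₁ refl 1≤n₁
    1≤m₂ : 1 ≤ m₂
    1≤m₂ = factor-posʳ (p ^ b) m₂ refl 1≤n₂
    ¬p∣m₁m₂ : ¬ p ∣ m₁ * m₂
    ¬p∣m₁m₂ = prime∤-* p-prime ¬p∣m₁ ¬p∣m₂
    regroup : p ^ a * m₁ * (p ^ b * m₂) ≡ p ^ (a ℕ.+ b) * (m₁ * m₂)
    regroup = trans (ℕ.[m*n]*[o*p]≡[m*o]*[n*p] (p ^ a) m₁ (p ^ b) m₂)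
                    (cong (_* (m₁ * m₂)) (sym (ℕ.^-distribˡ-+-* p a b)))
    coprime : Coprime (p ^ a * p ^ b) (m₁ * m₂)
    coprime = subst (λ q → Coprime q (m₁ * m₂)) (ℕ.^-distribˡ-+-* p a b) (coprime-^ p-prime ¬p∣m₁m₂ (a ℕ.+ b))
    smaller : m₁ * m₂ < p ^ a * m₁ * (p ^ b * m₂)
    smaller = subst (m₁ * m₂ <_) (sym regroup)
                (<-p^-* p-prime (a ℕ.+ b) (ℕ.*-mono-≤ 1≤m₁ 1≤m₂) ¬p∣m₁m₂ (subst (p ∣_) regroup p∣n₁n₂))

-- The Piltz divisor function

ε : ℕ → ℤ
ε (suc zero) = + 1
ε _          = + 0

piltz : ℕ → ℕ → ℤ
piltz zero    = ε
piltz (suc k) = 𝟙 ∗ piltz k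

ε-vanishes : ∀ {n} → 1 < n → ε n ≡ + 0
ε-vanishes {suc (suc _)} _           = refl
ε-vanishes {suc zero}    (s≤s ())

𝟙-multiplicative : Multiplicative 𝟙
𝟙-multiplicative _ _ _ = refl

ε-multiplicative : Multiplicative ε
ε-multiplicative {suc zero}    {n} _ _   _ = trans (cong ε (ℕ.*-identityˡ n)) (sym (ℤ.*-identityˡ (ε n)))
ε-multiplicative {suc (suc m)} {n} _ 1≤n _ =
  ε-vanishes (ℕ.≤-trans (ℕ.≤-reflexive (sym (ℕ.*-identityʳ 2))) (ℕ.*-mono-≤ (s≤s (s≤s (z≤n {m}))) 1≤n))

piltz-multiplicative : ∀ k → Multiplicative (piltz k)
piltz-multiplicative zero    = ε-multiplicative
piltz-multiplicative (suc k) = ∗-multiplicative {𝟙} {piltz k} 𝟙-multiplicative (piltz-multiplicative k)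

piltz-prime^ : ∀ {p} → Prime p → ∀ k e → piltz k (p ^ e) ≡ geometric^ k e
piltz-prime^ p-prime zero    zero    = refl
piltz-prime^ p-prime zero    (suc e) = ε-vanishes (ℕ.^-monoʳ-< _ (prime>1 p-prime) {0} {suc e} (s≤s z≤n))
piltz-prime^ {p} p-prime (suc k) e = trans (∑∣-prime^ p-prime e (λ a b → 𝟙 a · piltz k b))
  (∑-cong (suc e) (λ i → cong (_·_ (+ 1)) (piltz-prime^ p-prime k (e ∸ i))))

module _ {A B : Set} {P : Pred B 0ℓ} (P? : Decidable P) where

  filter-map : ∀ (h : A → B) xs → filter P? (map h xs) ≡ map h (filter (P? ∘ h) xs)
  filter-map h []       = refl
  filter-map h (x ∷ xs) with does (P? (h x))
  ... | true  = cong (h x ∷_) (filter-map h xs)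
  ... | false = filter-map h xs

  length-filter-concatMap : ∀ (g : A → List B) xs →
    + length (filter P? (concatMap g xs)) ≡ sumℤ (map (λ x → + length (filter P? (g x))) xs)
  length-filter-concatMap g []       = refl
  length-filter-concatMap g (x ∷ xs) = begin
    + length (filter P? (g x List.++ concatMap g xs))
      ≡⟨ cong (λ ys → + length ys) (filter-++ P? (g x) (concatMap g xs)) ⟩
    + length (filter P? (g x) List.++ filter P? (concatMap g xs))
      ≡⟨ cong +_ (length-++ (filter P? (g x))) ⟩
    + (length (filter P? (g x)) ℕ.+ length (filter P? (concatMap g xs)))
      ≡⟨ ℤ.pos-+ (length (filter P? (g x))) _ ⟩
    + length (filter P? (g x)) + + length (filter P? (concatMap g xs))
      ≡⟨ cong (_+_ (+ length (filter P? (g x)))) (length-filter-concatMap g xs) ⟩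
    sumℤ (map (λ x → + length (filter P? (g x))) (x ∷ xs))
      ∎
    where open ≡-Reasoning

prod : ∀ {k} → Vec ℕ k → ℕ
prod v = product (toList v)

count : ℕ → ℕ → ℕ → ℕ
count k N n = length (filter (λ v → prod v ℕ.≟ n) (tuples k N))

count-suc : ∀ k N n →
  + count (suc k) N n ≡ ∑[ x < N ] (+ length (filter (λ v → suc x * prod v ℕ.≟ n) (tuples k N)))
count-suc k N n = begin
  + count (suc k) N n
    ≡⟨ length-filter-concatMap P? (λ x → map (suc x Vec.∷_) (tuples k N)) (upTo N) ⟩
  sumℤ (map (λ x → + length (filter P? (map (suc x Vec.∷_) (tuples k N)))) (upTo N))
    ≡⟨ sumℤ-upTo N _ ⟩
  ∑[ x < N ] (+ length (filter P? (map (suc x Vec.∷_) (tuples k N))))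
    ≡⟨ ∑-cong N (λ x → cong (λ vs → + length vs) (filter-map P? (suc x Vec.∷_) (tuples k N))) ⟩
  ∑[ x < N ] (+ length (map (suc x Vec.∷_) (filter (λ v → suc x * prod v ℕ.≟ n) (tuples k N))))
    ≡⟨ ∑-cong N (λ x → cong +_ (length-map (suc x Vec.∷_) (filter (λ v → suc x * prod v ℕ.≟ n) (tuples k N)))) ⟩
  ∑[ x < N ] (+ length (filter (λ v → suc x * prod v ℕ.≟ n) (tuples k N)))
    ∎
  where
  open ≡-Reasoning
  P? : Decidable (λ (v : Vec ℕ (suc k)) → prod v ≡ n)
  P? v = prod v ℕ.≟ n

-- d k n = count k n n; a separate bound N lets the induction pass from n to the cofactors n / x.
count≡piltz : ∀ k {N n} → 1 ≤ n → n ≤ N → + count k N n ≡ piltz k n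
count≡piltz zero    {n = suc zero}    _ _ = refl
count≡piltz zero    {n = suc (suc _)} _ _ = refl
count≡piltz (suc k) {N} {n} 1≤n n≤N = begin
  + count (suc k) N n
    ≡⟨ count-suc k N n ⟩
  ∑[ x < N ] (+ length (filter (λ v → suc x * prod v ℕ.≟ n) (tuples k N)))
    ≡⟨ ∑-cong N (λ x → count-head x (suc x ∣? n)) ⟩
  ∑[ x < N ] guard (suc x ∣? n) (+ 1 · piltz k (n / suc x))
    ≡⟨ ∑-vanishing-tail n N _ n≤N (λ x n≤x _ → guard-no (suc x ∣? n)
         (λ x+1∣n → ℕ.<⇒≱ (s≤s n≤x) (∣⇒≤ {{ℕ.>-nonZero 1≤n}} x+1∣n))) ⟩
  piltz (suc k) n
    ∎
  where
  open ≡-Reasoning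
  count-head : ∀ x (x+1∣?n : Dec (suc x ∣ n)) →
    + length (filter (λ v → suc x * prod v ℕ.≟ n) (tuples k N)) ≡ guard x+1∣?n (+ 1 · piltz k (n / suc x))
  count-head x (no ¬x+1∣n) = cong (λ vs → + length vs) (filter-none (λ v → suc x * prod v ℕ.≟ n)
    (universal (λ v x+1*v≡n → ¬x+1∣n (factor-∣ˡ (suc x) (prod v) x+1*v≡n)) (tuples k N)))
  count-head x (yes x+1∣n@(divides q n≡q*x+1)) = begin
    + length (filter (λ v → suc x * prod v ℕ.≟ n) (tuples k N))
      ≡⟨ cong (λ vs → + length vs) (filter-≐ (λ v → suc x * prod v ℕ.≟ n) (λ v → prod v ℕ.≟ q)
                                               ((λ {v} → cancel {v}) , (λ {v} → uncancel {v})) (tuples k N)) ⟩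
    + count k N q
      ≡⟨ count≡piltz k 1≤q (ℕ.≤-trans (∣⇒≤ {{ℕ.>-nonZero 1≤n}} q∣n) n≤N) ⟩
    piltz k q
      ≡⟨ cong (piltz k) (sym (quotient-unique x x+1*q≡n)) ⟩
    piltz k (n / suc x)
      ≡⟨ sym (ℤ.*-identityˡ _) ⟩
    + 1 · piltz k (n / suc x)
      ∎
    where
    x+1*q≡n : suc x * q ≡ n
    x+1*q≡n = trans (ℕ.*-comm (suc x) q) (sym n≡q*x+1)
    q∣n : q ∣ n
    q∣n = factor-∣ʳ (suc x) q x+1*q≡n
    1≤q : 1 ≤ q
    1≤q = divisor-pos q∣n 1≤n
    cancel : ∀ {v : Vec ℕ k} → suc x * prod v ≡ n → prod v ≡ q
    cancel {v} eq = ℕ.*-cancelˡ-≡ (prod v) q (suc x) (trans eq (sym x+1*q≡n))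
    uncancel : ∀ {v : Vec ℕ k} → prod v ≡ q → suc x * prod v ≡ n
    uncancel v≡q = trans (cong (suc x *_) v≡q) x+1*q≡n

d≡piltz : ∀ k {n} → 1 ≤ n → + d k n ≡ piltz k n
d≡piltz k 1≤n = count≡piltz k 1≤n ℕ.≤-refl

divSum≡∑∣ : ∀ n (F : ℕ → ℕ → ℤ) → divSum n (λ i → F (suc i) (n / suc i)) ≡ ∑∣ n F
divSum≡∑∣ n F = sumℤ-upTo n _

rhs≡⊛ : ∀ k ϑ {n₁ n₂} → 1 ≤ n₁ → 1 ≤ n₂ → rhs k ϑ n₁ n₂ ≡ (ϑ ⊛ (piltz k ⊗ piltz k)) n₁ n₂
rhs≡⊛ k ϑ {n₁} {n₂} 1≤n₁ 1≤n₂ = begin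
  rhs k ϑ n₁ n₂
    ≡⟨ divSum≡∑∣ n₁ (λ a a′ → divSum n₂ (λ i → + d k a′ · + d k (n₂ / suc i) · ϑ a (suc i))) ⟩
  ∑[ a * a′ ≡ n₁ ] (divSum n₂ (λ i → + d k a′ · + d k (n₂ / suc i) · ϑ a (suc i)))
    ≡⟨ ∑∣-cong n₁ (λ a a′ _ → divSum≡∑∣ n₂ (λ b b′ → + d k a′ · + d k b′ · ϑ a b)) ⟩
  ∑[ a * a′ ≡ n₁ ] ∑[ b * b′ ≡ n₂ ] (+ d k a′ · + d k b′ · ϑ a b)
    ≡⟨ ∑∣-cong n₁ (λ a a′ aa′≡n₁ → ∑∣-cong n₂ (λ b b′ bb′≡n₂ → trans
         (cong₂ (λ x y → x · y · ϑ a b) (d≡piltz k (factor-posʳ a a′ aa′≡n₁ 1≤n₁))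
                                         (d≡piltz k (factor-posʳ b b′ bb′≡n₂ 1≤n₂)))
         (ℤ.*-comm (piltz k a′ · piltz k b′) (ϑ a b)))) ⟩
  (ϑ ⊛ (piltz k ⊗ piltz k)) n₁ n₂
    ∎
  where open ≡-Reasoning

piltz∘*-prime^ : ∀ k {p} → Prime p → ∀ a b → piltz k (p ^ a * p ^ b) ≡ geometric^ k (a ℕ.+ b)
piltz∘*-prime^ k {p} p-prime a b =
  trans (cong (piltz k) (sym (ℕ.^-distribˡ-+-* p a b))) (piltz-prime^ p-prime k (a ℕ.+ b))

⊛-prime^ : ∀ k ϑ → (∀ p ν₁ ν₂ → Prime p → ϑ (p ^ ν₁) (p ^ ν₂) ≡ θval k ν₁ ν₂) →
  ∀ {p} → Prime p → ∀ a b → (ϑ ⊛ (piltz k ⊗ piltz k)) (p ^ a) (p ^ b) ≡ geometric^ k (a ℕ.+ b)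
⊛-prime^ k ϑ ϑ-prime^ {p} p-prime a b = begin
  ∑[ a₁ * b₁ ≡ p ^ a ] ∑[ a₂ * b₂ ≡ p ^ b ] (ϑ a₁ a₂ · (piltz k b₁ · piltz k b₂))
    ≡⟨ ∑∣-prime^ p-prime a (λ a₁ b₁ → ∑[ a₂ * b₂ ≡ p ^ b ] (ϑ a₁ a₂ · (piltz k b₁ · piltz k b₂))) ⟩
  ∑[ i < suc a ] ∑[ a₂ * b₂ ≡ p ^ b ] (ϑ (p ^ i) a₂ · (piltz k (p ^ (a ∸ i)) · piltz k b₂))
    ≡⟨ ∑-cong (suc a) (λ i → ∑∣-prime^ p-prime b (λ a₂ b₂ → ϑ (p ^ i) a₂ · (piltz k (p ^ (a ∸ i)) · piltz k b₂))) ⟩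
  ∑[ i < suc a ] ∑[ j < suc b ] (ϑ (p ^ i) (p ^ j) · (piltz k (p ^ (a ∸ i)) · piltz k (p ^ (b ∸ j))))
    ≡⟨ ∑-cong (suc a) (λ i → ∑-cong (suc b) (λ j → trans
         (cong₂ _·_ (ϑ-prime^ p i j p-prime)
                    (cong₂ _·_ (piltz-prime^ p-prime k (a ∸ i)) (piltz-prime^ p-prime k (b ∸ j))))
         (ℤ.*-comm (θval k i j) _))) ⟩
  ∑[ i < suc a ] ∑[ j < suc b ] (geometric^ k (a ∸ i) · geometric^ k (b ∸ j) · θval k i j)
    ≡⟨ θval-local k a b ⟩
  geometric^ k (a ℕ.+ b)
    ∎
  where open ≡-Reasoning

corollary2 : (k : ℕ) → 1 ≤ k → (ϑ : ℕ → ℕ → ℤ) → IsMultiplicative₂ ϑ →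
    (∀ p ν₁ ν₂ → Prime p → ϑ (p ^ ν₁) (p ^ ν₂) ≡ θval k ν₁ ν₂) →
    (n₁ n₂ : ℕ) → 1 ≤ n₁ → 1 ≤ n₂ →
    + (d k (n₁ * n₂)) ≡ rhs k ϑ n₁ n₂
corollary2 k _ ϑ ϑ-multiplicative ϑ-prime^ n₁ n₂ 1≤n₁ 1≤n₂ = begin
  + d k (n₁ * n₂)                    ≡⟨ d≡piltz k (ℕ.*-mono-≤ 1≤n₁ 1≤n₂) ⟩
  piltz k (n₁ * n₂)                  ≡⟨ multiplicative₂-unique lhs-multiplicative rhs-multiplicative
                                          agree 1≤n₁ 1≤n₂ ⟩
  (ϑ ⊛ (piltz k ⊗ piltz k)) n₁ n₂    ≡⟨ sym (rhs≡⊛ k ϑ 1≤n₁ 1≤n₂) ⟩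
  rhs k ϑ n₁ n₂                      ∎
  where
  open ≡-Reasoning
  lhs-multiplicative : Multiplicative₂ (λ m n → piltz k (m * n))
  lhs-multiplicative = multiplicative-∘* {piltz k} (piltz-multiplicative k)
  rhs-multiplicative : Multiplicative₂ (ϑ ⊛ (piltz k ⊗ piltz k))
  rhs-multiplicative = ⊛-multiplicative {ϑ} {piltz k ⊗ piltz k} (isMultiplicative₂⇒multiplicative₂ {ϑ} ϑ-multiplicative)
                         (⊗-multiplicative {piltz k} {piltz k} (piltz-multiplicative k) (piltz-multiplicative k))
  agree : ∀ p a b → Prime p → piltz k (p ^ a * p ^ b) ≡ (ϑ ⊛ (piltz k ⊗ piltz k)) (p ^ a) (p ^ b)
  agree p a b p-prime = trans (piltz∘*-prime^ k p-prime a b) (sym (⊛-prime^ k ϑ ϑ-prime^ p-prime a b))
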